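{- Let $X$ be a finite graph, $\epsilon>0$ and $\alpha<\frac12$ (with $\alpha>0$). Suppose $X$ has an $\epsilon$-Følner set $F$ that is maximal with respect to inclusion among $\epsilon$-Følner sets and is $\alpha$-small. Then there exists $\delta=\delta(\epsilon,\alpha)>0$ such that $X$ can be decomposed as $X = F\sqcup Y_1\sqcup\cdots\sqcup Y_k$ where each $Y_i$ is a $\delta$-expander and is $(\frac12-\alpha)$-big in $X$.
   Context: All graphs are finite, with no multiple edges and no loops; $|X|$ denotes the number of vertices. A subset of vertices is regarded as a subgraph by keeping all edges of $X$ with both endpoints in it (induced subgraph). For a graph $G$ and $A\subseteq G$, $\partial A$ is the set of edges of $G$ joining a vertex of $A$ to a vertex of $G\setminus A$. For $\epsilon>0$, a non-empty $A\subseteq G$ is an $\epsilon$-Følner set of $G$ if $|A|\le \frac12|G|$ and $|\partial A|\le\epsilon|A|$ (boundary in $G$). $G$ is an $\epsilon$-expander if it has no $\epsilon$-Følner sets. A subset $A\subseteq X$ is $\alpha$-big (in $X$) if $|A|\ge\alpha|X|$ and $\alpha$-small if $|A|<\alpha|X|$. A decomposition $X=X_1\sqcup\cdots\sqcup X_n$ means the $X_i$ are induced subgraphs arising from a partition of the vertex set of $X$ (edges between different $X_i$ are allowed).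
   Formalization: The parameters ε and α are taken to be rational. -}

module Defs where

open import Data.Nat using (ℕ; zero; suc; _+_; _*_; _≤_)
open import Data.Bool using (Bool; true; false; _∧_; not; if_then_else_)
open import Data.Fin using (Fin; zero; suc)
open import Data.Fin.Subset using (Subset; _∈_; _∉_; _⊆_; ∣_∣; Nonempty)
open import Data.Vec using (lookup; tabulate)
open import Data.Integer using (+_)
open import Data.Rational using (ℚ; _/_)
import Data.Rational as Q
open import Data.Product using (Σ; _×_; _,_)
open import Relation.Nullary using (¬_)
open import Relation.Binary.PropositionalEquality using (_≡_)

record Graph : Set where
  field
    n     : ℕ
    adj   : Fin n → Fin n → Bool
    sym   : ∀ u v → adj u v ≡ adj v u
    irrefl : ∀ v → adj v v ≡ false
open Graph public

ℕ→ℚ : ℕ → ℚ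
ℕ→ℚ k = (+ k) / 1

∑ : ∀ {k} → (Fin k → ℕ) → ℕ
∑ {zero}  f = 0
∑ {suc k} f = f zero + ∑ (λ i → f (suc i))

b2n : Bool → ℕ
b2n true  = 1
b2n false = 0

-- Number of edges of the induced subgraph S joining a vertex of A to a
-- vertex of S \ A.  Each such (unordered) edge {u,v} is counted once, via
-- the unique orientation with u ∈ A and v ∉ A.
∂in : (X : Graph) → Subset (n X) → Subset (n X) → ℕ
∂in X S A = ∑ λ u → ∑ λ v →
  b2n (adj X u v ∧ lookup A u ∧ not (lookup A v) ∧ lookup S v)

full : (X : Graph) → Subset (n X)
full X = tabulate (λ _ → true)

IsFolnerIn : (X : Graph) → ℚ → Subset (n X) → Subset (n X) → Set
IsFolnerIn X ε S A =
  A ⊆ S × Nonempty A × 2 * ∣ A ∣ ≤ ∣ S ∣ ×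
  ℕ→ℚ (∂in X S A) Q.≤ ε Q.* ℕ→ℚ ∣ A ∣

IsFolner : (X : Graph) → ℚ → Subset (n X) → Set
IsFolner X ε A = IsFolnerIn X ε (full X) A

IsMaximalFolner : (X : Graph) → ℚ → Subset (n X) → Set
IsMaximalFolner X ε F =
  IsFolner X ε F × (∀ G → IsFolner X ε G → F ⊆ G → G ⊆ F)

IsExpanderIn : (X : Graph) → ℚ → Subset (n X) → Set
IsExpanderIn X ε S = ∀ A → ¬ IsFolnerIn X ε S A

IsSmall : (X : Graph) → ℚ → Subset (n X) → Set
IsSmall X α A = ℕ→ℚ ∣ A ∣ Q.< α Q.* ℕ→ℚ (n X)

IsBig : (X : Graph) → ℚ → Subset (n X) → Set
IsBig X α A = α Q.* ℕ→ℚ (n X) Q.≤ ℕ→ℚ ∣ A ∣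

-- Decomposition X = F ⊔ Y₁ ⊔ ... ⊔ Y_k is encoded by a labelling
-- lab : vertices → Fin (suc k); label zero means "in F", label (suc i)
-- means "in Y_i".
part : (X : Graph) {k : ℕ} → (Fin (n X) → Fin (suc k)) → Fin k → Subset (n X)
part X lab i = tabulate (λ v → isLabel (lab v))
  where
  isLabel : Fin _ → Bool
  isLabel zero    = false
  isLabel (suc j) = eqFin j i
    where
    eqFin : ∀ {m} → Fin m → Fin m → Bool
    eqFin zero    zero    = true
    eqFin (suc a) (suc b) = eqFin a b
    eqFin _       _       = false

{-# OPTIONS --safe #-}
module Submission where

-- Refine a partition of Y = X ∖ F, starting from the single block Y. While some block Yᵢ contains a
-- (1/M)-Følner set A, either move A into a block that receives more of its edges than Yᵢ ∖ A does,
-- which strictly decreases the number of edges between blocks, or split A off as a new block, which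
-- adds at most 2|A|/M ≤ 2|X|/M of them. Every block B keeps |∂_Y B| ≤ |B| / den ε ≤ ε|B|, so by
-- maximality of F the set F ∪ B is not ε-Følner, i.e. |F ∪ B| > |X|/2: B is (½ − α)-big and has more
-- than |X|/c vertices (c = 2 den α), hence there are fewer than c blocks. The invariant survives a
-- step: a block that loses A keeps half of its vertices, and its boundary in Y is at most the number of
-- edges between blocks, ≤ 2c|X|/M; a new block A has boundary at most c|∂_{Yᵢ} A| ≤ c|A|/M. This is
-- where M = 4 den ε c² + 1 comes from. The pair (c − #blocks, #edges between blocks) decreases
-- lexicographically, so the refinement stops, and then every block is a (1/M)-expander.

open import Defs hiding (sym)
open import Data.Nat using (ℕ)
import Data.Nat as ℕ
open import Data.Fin.Subset using (Subset; ∣_∣)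
open import Data.Rational using (ℚ)
import Data.Rational as ℚ

module Counting where

  open import Data.Nat
  open import Data.Nat.Properties
  open import Data.Bool using (Bool; true; false; _∧_; _∨_; not)
  open import Data.Fin using (Fin; zero; suc)
  open import Data.Vec using (_∷_; []; lookup)
  open import Data.Product using (∃; _,_)
  open import Function using (_∘_)
  open import Relation.Binary.PropositionalEquality
  open import Algebra.Properties.Semiring.Sum +-*-semiring using (sum; sum-cong-≗; ∑-distrib-+)

  ∑≡sum : ∀ {k} (f : Fin k → ℕ) → ∑ f ≡ sum f
  ∑≡sum {zero}  f = refl
  ∑≡sum {suc k} f = cong (f zero +_) (∑≡sum (f ∘ suc))

  sum-mono-≤ : ∀ {k} {f g : Fin k → ℕ} → (∀ i → f i ≤ g i) → sum f ≤ sum g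
  sum-mono-≤ {zero}  f≤g = z≤n
  sum-mono-≤ {suc k} f≤g = +-mono-≤ (f≤g zero) (sum-mono-≤ (f≤g ∘ suc))

  sum-mono-< : ∀ {k} {f g : Fin (suc k) → ℕ} → (∀ i → f i < g i) → sum f < sum g
  sum-mono-< f<g = +-mono-<-≤ (f<g zero) (sum-mono-≤ (<⇒≤ ∘ f<g ∘ suc))

  sum-const : ∀ k (x : ℕ) → sum {k} (λ _ → x) ≡ k * x
  sum-const zero    x = refl
  sum-const (suc k) x = cong (x +_) (sum-const k x)

  sum-zero : ∀ k → sum {k} (λ _ → 0) ≡ 0
  sum-zero k = trans (sum-const k 0) (*-zeroʳ k)

  card : ∀ {m} → (Fin m → Bool) → ℕ
  card p = sum (b2n ∘ p)

  card-cong : ∀ {m} {p q : Fin m → Bool} → (∀ v → p v ≡ q v) → card p ≡ card q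
  card-cong p≗q = sum-cong-≗ (cong b2n ∘ p≗q)

  ∣∣≡card : ∀ {m} (A : Subset m) → ∣ A ∣ ≡ card (lookup A)
  ∣∣≡card []          = refl
  ∣∣≡card (true  ∷ A) = cong suc (∣∣≡card A)
  ∣∣≡card (false ∷ A) = ∣∣≡card A

  b2n≤1 : ∀ b → b2n b ≤ 1
  b2n≤1 true  = ≤-refl
  b2n≤1 false = z≤n

  card≤ : ∀ {m} (p : Fin m → Bool) → card p ≤ m
  card≤ {m} p = begin
    card p           ≤⟨ sum-mono-≤ (b2n≤1 ∘ p) ⟩
    sum {m} (λ _ → 1) ≡⟨ sum-const m 1 ⟩
    m * 1            ≡⟨ *-identityʳ m ⟩
    m                ∎
    where open ≤-Reasoning

  card-full : ∀ m → card {m} (λ _ → true) ≡ m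
  card-full m = trans (sum-const m 1) (*-identityʳ m)

  card-mono : ∀ {m} {p q : Fin m → Bool} → (∀ v → p v ≡ true → q v ≡ true) → card p ≤ card q
  card-mono {p = p} {q} p⊆q = sum-mono-≤ λ v → b2n-mono (p v) (q v) (p⊆q v)
    where
    b2n-mono : ∀ x y → (x ≡ true → y ≡ true) → b2n x ≤ b2n y
    b2n-mono false y       _ = z≤n
    b2n-mono true  true    _ = ≤-refl
    b2n-mono true  false x⇒y with () ← x⇒y refl

  card-split : ∀ {m} (p r : Fin m → Bool) →
    card p ≡ card (λ v → p v ∧ not (r v)) + card (λ v → p v ∧ r v)
  card-split p r = trans (sum-cong-≗ λ v → split (p v) (r v))
    (∑-distrib-+ (λ v → b2n (p v ∧ not (r v))) (λ v → b2n (p v ∧ r v)))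
    where
    split : ∀ x y → b2n x ≡ b2n (x ∧ not y) + b2n (x ∧ y)
    split false _     = refl
    split true  false = refl
    split true  true  = refl

  card-∨ : ∀ {m} (p q : Fin m → Bool) → (∀ v → p v ≡ true → q v ≡ false) →
    card (λ v → p v ∨ q v) ≡ card p + card q
  card-∨ p q disjoint = trans (sum-cong-≗ λ v → b2n-∨ (p v) (q v) (disjoint v))
    (∑-distrib-+ (b2n ∘ p) (b2n ∘ q))
    where
    b2n-∨ : ∀ x y → (x ≡ true → y ≡ false) → b2n (x ∨ y) ≡ b2n x + b2n y
    b2n-∨ false y     _ = refl
    b2n-∨ true  false _ = refl
    b2n-∨ true  true  x⇒¬y with () ← x⇒¬y refl

  card-nonempty : ∀ {m} (p : Fin m → Bool) → 0 < card p → ∃ λ v → p v ≡ true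
  card-nonempty {zero}  p ()
  card-nonempty {suc m} p 0<card with p zero in p0
  ... | true  = zero , p0
  ... | false = let v , pv = card-nonempty (p ∘ suc) 0<card in suc v , pv

module RationalBounds where

  open import Data.Nat
  open import Data.Nat.Properties
  open import Data.Nat.Coprimality using (1-coprimeTo)
  open import Data.Nat.Tactic.RingSolver using (solve)
  open import Data.List using ([]; _∷_)
  open import Data.Integer as ℤ using (+_; -[1+_]; +≤+; +<+)
  import Data.Integer.Properties as ℤ
  open import Data.Rational as ℚ using (ℚ; mkℚ; ↥_; ↧ₙ_; ½; 0ℚ; toℚᵘ; *<*)
  import Data.Rational.Properties as ℚ
  open import Data.Rational.Solver using (module +-*-Solver)
  open import Data.Rational.Unnormalised as ℚᵘ using (mkℚᵘ; _≃_)
  import Data.Rational.Unnormalised.Properties as ℚᵘ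
  open import Function.Bundles using (_⇔_; mk⇔; Equivalence)
  open import Relation.Binary.PropositionalEquality

  -- ℚ normalises by gcd, so inequalities are moved to unnormalised fractions and cross-multiplied.
  private
    +≤+⇔ : ∀ m b n d → (mkℚᵘ (+ m) b ℚᵘ.≤ mkℚᵘ (+ n) d) ⇔ (m * suc d ≤ n * suc b)
    +≤+⇔ m b n d = mk⇔
      (λ { (ℚᵘ.*≤* le) → ℤ.drop‿+≤+ (subst₂ ℤ._≤_ (sym (ℤ.pos-* m _)) (sym (ℤ.pos-* n _)) le) })
      (λ le → ℚᵘ.*≤* (subst₂ ℤ._≤_ (ℤ.pos-* m _) (ℤ.pos-* n _) (+≤+ le)))

    +<+⇒ : ∀ m b n d → mkℚᵘ (+ m) b ℚᵘ.< mkℚᵘ (+ n) d → m * suc d < n * suc b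
    +<+⇒ m b n d (ℚᵘ.*<* lt) = ℤ.drop‿+<+ (subst₂ ℤ._<_ (sym (ℤ.pos-* m _)) (sym (ℤ.pos-* n _)) lt)

    toℚᵘ-ℕ→ℚ : ∀ m → toℚᵘ (ℕ→ℚ m) ≃ mkℚᵘ (+ m) 0
    toℚᵘ-ℕ→ℚ m = ℚ.toℚᵘ-fromℚᵘ (mkℚᵘ (+ m) 0)

    toℚᵘ-*ℕ→ℚ : ∀ r {p} n → ↥ r ≡ + p → toℚᵘ (r ℚ.* ℕ→ℚ n) ≃ mkℚᵘ (+ (p * n)) (pred (↧ₙ r))
    toℚᵘ-*ℕ→ℚ r@record{} {p} n ↥r≡p = ℚᵘ.≃-trans (ℚ.toℚᵘ-homo-* r (ℕ→ℚ n))
      (ℚᵘ.≃-trans (ℚᵘ.*-congˡ {toℚᵘ r} (toℚᵘ-ℕ→ℚ n)) (ℚᵘ.≃-reflexive r*n≡))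
      where
      r*n≡ : toℚᵘ r ℚᵘ.* mkℚᵘ (+ n) 0 ≡ mkℚᵘ (+ (p * n)) (pred (↧ₙ r))
      r*n≡ = cong₂ mkℚᵘ (trans (cong (ℤ._* + n) ↥r≡p) (sym (ℤ.pos-* p n))) (*-identityʳ (pred (↧ₙ r)))

  ℕ→ℚ-mono-≤ : ∀ {m n} → m ≤ n → ℕ→ℚ m ℚ.≤ ℕ→ℚ n
  ℕ→ℚ-mono-≤ {m} {n} m≤n = ℚ.toℚᵘ-cancel-≤
    (ℚᵘ.≤-respˡ-≃ (ℚᵘ.≃-sym (toℚᵘ-ℕ→ℚ m)) (ℚᵘ.≤-respʳ-≃ (ℚᵘ.≃-sym (toℚᵘ-ℕ→ℚ n))
      (Equivalence.from (+≤+⇔ m 0 n 0) (*-monoˡ-≤ 1 m≤n))))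

  ℕ→ℚ-+ : ∀ m n → ℕ→ℚ (m + n) ≡ ℕ→ℚ m ℚ.+ ℕ→ℚ n
  ℕ→ℚ-+ m n = ℚ.toℚᵘ-injective (ℚᵘ.≃-trans (toℚᵘ-ℕ→ℚ (m + n))
    (ℚᵘ.≃-trans sum≃ (ℚᵘ.≃-sym (ℚᵘ.≃-trans (ℚ.toℚᵘ-homo-+ (ℕ→ℚ m) (ℕ→ℚ n))
                                            (ℚᵘ.+-cong (toℚᵘ-ℕ→ℚ m) (toℚᵘ-ℕ→ℚ n))))))
    where
    sum≃ : mkℚᵘ (+ (m + n)) 0 ≃ mkℚᵘ (+ m) 0 ℚᵘ.+ mkℚᵘ (+ n) 0
    sum≃ = ℚᵘ.*≡* (cong (ℤ._* + 1) (trans (ℤ.pos-+ m n)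
             (sym (cong₂ ℤ._+_ (ℤ.*-identityʳ (+ m)) (ℤ.*-identityʳ (+ n))))))

  ≤*ℕ→ℚ-+ : ∀ r {g x y m n} → g ≤ x + y → ℕ→ℚ x ℚ.≤ r ℚ.* ℕ→ℚ m → ℕ→ℚ y ℚ.≤ r ℚ.* ℕ→ℚ n →
    ℕ→ℚ g ℚ.≤ r ℚ.* ℕ→ℚ (m + n)
  ≤*ℕ→ℚ-+ r {g} {x} {y} {m} {n} g≤x+y x≤rm y≤rn = begin
    ℕ→ℚ g                              ≤⟨ ℕ→ℚ-mono-≤ g≤x+y ⟩
    ℕ→ℚ (x + y)                        ≡⟨ ℕ→ℚ-+ x y ⟩
    ℕ→ℚ x ℚ.+ ℕ→ℚ y                    ≤⟨ ℚ.+-mono-≤ x≤rm y≤rn ⟩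
    r ℚ.* ℕ→ℚ m ℚ.+ r ℚ.* ℕ→ℚ n        ≡⟨ ℚ.*-distribˡ-+ r (ℕ→ℚ m) (ℕ→ℚ n) ⟨
    r ℚ.* (ℕ→ℚ m ℚ.+ ℕ→ℚ n)            ≡⟨ cong (r ℚ.*_) (ℕ→ℚ-+ m n) ⟨
    r ℚ.* ℕ→ℚ (m + n)                  ∎
    where open ℚ.≤-Reasoning

  ℕ→ℚ≤*ℕ→ℚ⇔ : ∀ r {p} m n → ↥ r ≡ + p → (ℕ→ℚ m ℚ.≤ r ℚ.* ℕ→ℚ n) ⇔ (m * ↧ₙ r ≤ p * n)
  ℕ→ℚ≤*ℕ→ℚ⇔ r {p} m n ↥r≡p = mk⇔
    (λ le → subst (m * ↧ₙ r ≤_) (*-identityʳ (p * n)) (Equivalence.to (+≤+⇔ m 0 (p * n) _)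
       (ℚᵘ.≤-respˡ-≃ (toℚᵘ-ℕ→ℚ m) (ℚᵘ.≤-respʳ-≃ rhs≃ (ℚ.toℚᵘ-mono-≤ le)))))
    (λ le → ℚ.toℚᵘ-cancel-≤ (ℚᵘ.≤-respˡ-≃ (ℚᵘ.≃-sym (toℚᵘ-ℕ→ℚ m)) (ℚᵘ.≤-respʳ-≃ (ℚᵘ.≃-sym rhs≃)
       (Equivalence.from (+≤+⇔ m 0 (p * n) _) (subst (m * ↧ₙ r ≤_) (sym (*-identityʳ (p * n))) le)))))
    where rhs≃ = toℚᵘ-*ℕ→ℚ r n ↥r≡p

  ℕ→ℚ<*ℕ→ℚ⇒ : ∀ r {p} m n → ↥ r ≡ + p → ℕ→ℚ m ℚ.< r ℚ.* ℕ→ℚ n → m * ↧ₙ r < p * n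
  ℕ→ℚ<*ℕ→ℚ⇒ r {p} m n ↥r≡p lt = subst (m * ↧ₙ r <_) (*-identityʳ (p * n)) (+<+⇒ m 0 (p * n) _
    (ℚᵘ.<-respˡ-≃ (toℚᵘ-ℕ→ℚ m) (ℚᵘ.<-respʳ-≃ (toℚᵘ-*ℕ→ℚ r n ↥r≡p) (ℚ.toℚᵘ-mono-< lt))))

  *ℕ→ℚ≤ℕ→ℚ⇐ : ∀ r {p} m n → ↥ r ≡ + p → p * n ≤ m * ↧ₙ r → r ℚ.* ℕ→ℚ n ℚ.≤ ℕ→ℚ m
  *ℕ→ℚ≤ℕ→ℚ⇐ r {p} m n ↥r≡p le = ℚ.toℚᵘ-cancel-≤
    (ℚᵘ.≤-respˡ-≃ (ℚᵘ.≃-sym (toℚᵘ-*ℕ→ℚ r n ↥r≡p)) (ℚᵘ.≤-respʳ-≃ (ℚᵘ.≃-sym (toℚᵘ-ℕ→ℚ m))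
      (Equivalence.from (+≤+⇔ (p * n) _ m 0) (subst (_≤ m * ↧ₙ r) (sym (*-identityʳ (p * n))) le))))

  1/suc : ℕ → ℚ
  1/suc m = mkℚ (+ 1) m (1-coprimeTo (suc m))

  1/suc-positive : ∀ m → 0ℚ ℚ.< 1/suc m
  1/suc-positive m = *<* (+<+ (s≤s z≤n))

  ≤-1/suc-*⇒ : ∀ m {x y} → ℕ→ℚ x ℚ.≤ 1/suc m ℚ.* ℕ→ℚ y → suc m * x ≤ y
  ≤-1/suc-*⇒ m {x} {y} le =
    subst₂ _≤_ (*-comm x (suc m)) (*-identityˡ y) (Equivalence.to (ℕ→ℚ≤*ℕ→ℚ⇔ (1/suc m) x y refl) le)

  denominator-bound : ∀ ε {e s} → 0ℚ ℚ.< ε → ↧ₙ ε * e ≤ s → ℕ→ℚ e ℚ.≤ ε ℚ.* ℕ→ℚ s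
  denominator-bound (mkℚ (+ suc p) d _) {e} {s} _ de≤s =
    Equivalence.from (ℕ→ℚ≤*ℕ→ℚ⇔ (mkℚ (+ suc p) d _) e s refl) (begin
      e * suc d   ≡⟨ *-comm e (suc d) ⟩
      suc d * e   ≤⟨ de≤s ⟩
      s           ≤⟨ m≤m+n s (p * s) ⟩
      suc p * s   ∎)
    where open ≤-Reasoning
  denominator-bound (mkℚ (+ zero)   _ _) (*<* (+<+ ()))
  denominator-bound (mkℚ -[1+ _ ]   _ _) (*<* ())

  private
    small-fractionℕ : ∀ p q f N → p * 2 < q → f * q < p * N → 2 * (N + 2 * q * f) < 2 * q * N
    small-fractionℕ p q f N 2p<q fq<pN = begin-strict
      2 * (N + 2 * q * f)       ≡⟨ solve (N ∷ q ∷ f ∷ []) ⟩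
      2 * N + 4 * (f * q)       <⟨ +-monoʳ-< (2 * N) (*-monoʳ-< 4 fq<pN) ⟩
      2 * N + 4 * (p * N)       ≡⟨ solve (N ∷ p ∷ []) ⟩
      suc (p * 2) * (2 * N)     ≤⟨ *-monoˡ-≤ (2 * N) 2p<q ⟩
      q * (2 * N)               ≡⟨ solve (N ∷ q ∷ []) ⟩
      2 * q * N                 ∎
      where open ≤-Reasoning

  small-fraction : ∀ α {f N} → 0ℚ ℚ.< α → α ℚ.< ½ → ℕ→ℚ f ℚ.< α ℚ.* ℕ→ℚ N →
    2 * (N + 2 * ↧ₙ α * f) < 2 * ↧ₙ α * N
  small-fraction α@(mkℚ (+ p) d _) {f} {N} _ α<½ f<αN =
    small-fractionℕ p (suc d) f N
      (subst (p * 2 <_) (*-identityˡ (suc d))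
        (ℤ.drop‿+<+ (subst₂ ℤ._<_ (sym (ℤ.pos-* p 2)) (sym (ℤ.pos-* 1 (suc d))) (ℚ.drop-*<* α<½))))
      (ℕ→ℚ<*ℕ→ℚ⇒ α f N refl f<αN)
  small-fraction (mkℚ -[1+ _ ] _ _) (*<* ())

  ½-minus-bound : ∀ α {f m n} → ℕ→ℚ f ℚ.< α ℚ.* ℕ→ℚ n → n ≤ 2 * (f + m) →
    (½ ℚ.- α) ℚ.* ℕ→ℚ n ℚ.≤ ℕ→ℚ m
  ½-minus-bound α {f} {m} {n} f<αn n≤2[f+m] = begin
    (½ ℚ.- α) ℚ.* n′              ≡⟨ distrib ⟩
    ½ ℚ.* n′ ℚ.- α ℚ.* n′         ≤⟨ ℚ.+-monoʳ-≤ (½ ℚ.* n′) (ℚ.neg-antimono-≤ (ℚ.<⇒≤ f<αn)) ⟩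
    ½ ℚ.* n′ ℚ.- ℕ→ℚ f            ≤⟨ ℚ.+-monoˡ-≤ (ℚ.- ℕ→ℚ f) ½n≤f+m ⟩
    ℕ→ℚ (f + m) ℚ.- ℕ→ℚ f         ≡⟨ cong (ℚ._- ℕ→ℚ f) (ℕ→ℚ-+ f m) ⟩
    ℕ→ℚ f ℚ.+ ℕ→ℚ m ℚ.- ℕ→ℚ f    ≡⟨ cancel ⟩
    ℕ→ℚ m                         ∎
    where
    open ℚ.≤-Reasoning
    open +-*-Solver using (_:+_; _:-_; _:*_; _:=_)
    n′ = ℕ→ℚ n
    distrib : (½ ℚ.- α) ℚ.* n′ ≡ ½ ℚ.* n′ ℚ.- α ℚ.* n′
    distrib = +-*-Solver.solve 3 (λ h a x → (h :- a) :* x := h :* x :- a :* x) refl ½ α n′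
    cancel : ℕ→ℚ f ℚ.+ ℕ→ℚ m ℚ.- ℕ→ℚ f ≡ ℕ→ℚ m
    cancel = +-*-Solver.solve 2 (λ x y → x :+ y :- x := y) refl (ℕ→ℚ f) (ℕ→ℚ m)
    ½n≤f+m : ½ ℚ.* n′ ℚ.≤ ℕ→ℚ (f + m)
    ½n≤f+m = *ℕ→ℚ≤ℕ→ℚ⇐ ½ (f + m) n refl
      (subst₂ _≤_ (sym (*-identityˡ n)) (*-comm 2 (f + m)) n≤2[f+m])

module Arithmetic where

  open import Data.Nat
  open import Data.Nat.Properties
  open import Data.Nat.Tactic.RingSolver using (solve)
  open import Data.List using ([]; _∷_)
  open import Relation.Binary.PropositionalEquality

  0<-factorˡ : ∀ {x y z} → x < y * z → 0 < y
  0<-factorˡ {y = suc _} _ = z<s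

  0<-factorʳ : ∀ {x y z} → x < y * z → 0 < z
  0<-factorʳ {x} {y} {z} x<yz = 0<-factorˡ {x} {z} {y} (subst (x <_) (*-comm y z) x<yz)

  halving : ∀ {x y z} → x ≤ y + z → 2 * z ≤ x → x ≤ 2 * y
  halving {x} {y} {z} x≤y+z 2z≤x = +-cancelʳ-≤ x x (2 * y) (begin
    x + x          ≡⟨ solve (x ∷ []) ⟩
    2 * x          ≤⟨ *-monoʳ-≤ 2 x≤y+z ⟩
    2 * (y + z)    ≡⟨ *-distribˡ-+ 2 y z ⟩
    2 * y + 2 * z  ≤⟨ +-monoʳ-≤ (2 * y) 2z≤x ⟩
    2 * y + x      ∎)
    where open ≤-Reasoning

  proper-part : ∀ {N c f} → 2 * (N + c * f) < c * N → f < N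
  proper-part {N} {c} {f} small = ≰⇒> λ N≤f → <-irrefl refl (begin-strict
    c * N              ≤⟨ *-monoʳ-≤ c N≤f ⟩
    c * f              ≤⟨ m≤n+m (c * f) N ⟩
    N + c * f          ≤⟨ m≤m+n (N + c * f) _ ⟩
    2 * (N + c * f)    <⟨ small ⟩
    c * N              ∎)
    where open ≤-Reasoning

  fraction-gap : ∀ {N c f b} → 2 * (N + c * f) < c * N → N < 2 * (f + b) → N < c * b
  fraction-gap {N} {c} {f} {b} small N<2[f+b] =
    *-cancelˡ-< 2 N (c * b) (+-cancelˡ-< (2 * (c * f)) (2 * N) (2 * (c * b)) (begin-strict
      2 * (c * f) + 2 * N        ≡⟨ solve (c ∷ f ∷ N ∷ []) ⟩
      2 * (N + c * f)            <⟨ small ⟩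
      c * N                      ≤⟨ *-monoʳ-≤ c (<⇒≤ N<2[f+b]) ⟩
      c * (2 * (f + b))          ≡⟨ solve (c ∷ f ∷ b ∷ []) ⟩
      2 * (c * f) + 2 * (c * b)  ∎))
    where open ≤-Reasoning

  lex-< : ∀ {x y q d d′} → x < y → d′ < q → x * q + d′ < y * q + d
  lex-< {x} {y} {q} {d} {d′} x<y d′<q = begin-strict
    x * q + d′     <⟨ +-monoʳ-< (x * q) d′<q ⟩
    x * q + q      ≡⟨ +-comm (x * q) q ⟩
    suc x * q      ≤⟨ *-monoˡ-≤ q x<y ⟩
    y * q          ≤⟨ m≤m+n (y * q) d ⟩
    y * q + d      ∎
    where open ≤-Reasoning

module Descent where

  open import Data.Nat using (ℕ; _<_)
  open import Data.Nat.Induction using (<-wellFounded)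
  open import Data.Product using (Σ; _,_)
  open import Data.Sum using (_⊎_; inj₁; inj₂)
  open import Function using (_on_)
  open import Induction.WellFounded using (Acc; acc)
  open import Relation.Binary.Construct.On as On using ()

  descend : ∀ {S : Set} (μ : S → ℕ) {P : S → Set} → (∀ s → P s ⊎ Σ S λ s′ → μ s′ < μ s) → S → Σ S P
  descend {S} μ {P} step s = go s (On.wellFounded μ <-wellFounded s)
    where
    go : ∀ s → Acc (_<_ on μ) s → Σ S P
    go s (acc rs) with step s
    ... | inj₁ done          = s , done
    ... | inj₂ (s′ , μs′<μs) = go s′ (rs μs′<μs)

module EdgeCounts (X : Graph) where

  open Counting

  open import Data.Nat
  open import Data.Nat.Properties
  open import Data.Bool using (Bool; true; false; _∧_; _∨_; not)
  open import Data.Fin using (Fin)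
  open import Data.Vec using (lookup)
  open import Relation.Binary.PropositionalEquality
  open import Algebra.Properties.Semiring.Sum +-*-semiring
    using (sum; sum-cong-≗; ∑-distrib-+; ∑-comm; *-distribˡ-sum)

  private
    b2n-∧ : ∀ x y → b2n (x ∧ y) ≡ b2n x * b2n y
    b2n-∧ false y = refl
    b2n-∧ true  y = sym (+-identityʳ (b2n y))

  V : Set
  V = Fin (n X)

  ∑ᴱ : (V → V → ℕ) → ℕ
  ∑ᴱ w = sum λ u → sum λ v → b2n (adj X u v) * w u v

  ∑ᴱ-cong : ∀ {w w′ : V → V → ℕ} → (∀ u v → w u v ≡ w′ u v) → ∑ᴱ w ≡ ∑ᴱ w′
  ∑ᴱ-cong w≗w′ = sum-cong-≗ λ u → sum-cong-≗ λ v → cong (b2n (adj X u v) *_) (w≗w′ u v)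

  ∑ᴱ-mono-≤ : ∀ {w w′ : V → V → ℕ} → (∀ u v → w u v ≤ w′ u v) → ∑ᴱ w ≤ ∑ᴱ w′
  ∑ᴱ-mono-≤ w≤w′ = sum-mono-≤ λ u → sum-mono-≤ λ v → *-monoʳ-≤ (b2n (adj X u v)) (w≤w′ u v)

  ∑ᴱ-distrib-+ : ∀ (w w′ : V → V → ℕ) → ∑ᴱ (λ u v → w u v + w′ u v) ≡ ∑ᴱ w + ∑ᴱ w′
  ∑ᴱ-distrib-+ w w′ = begin
    ∑ᴱ (λ u v → w u v + w′ u v)
      ≡⟨ sum-cong-≗ (λ u → sum-cong-≗ λ v → *-distribˡ-+ (b2n (adj X u v)) (w u v) (w′ u v)) ⟩
    sum (λ u → sum λ v → b2n (adj X u v) * w u v + b2n (adj X u v) * w′ u v)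
      ≡⟨ sum-cong-≗ (λ u → ∑-distrib-+ (λ v → b2n (adj X u v) * w u v) (λ v → b2n (adj X u v) * w′ u v)) ⟩
    sum (λ u → sum (λ v → b2n (adj X u v) * w u v) + sum (λ v → b2n (adj X u v) * w′ u v))
      ≡⟨ ∑-distrib-+ (λ u → sum λ v → b2n (adj X u v) * w u v) (λ u → sum λ v → b2n (adj X u v) * w′ u v) ⟩
    ∑ᴱ w + ∑ᴱ w′ ∎
    where open ≡-Reasoning

  ∑ᴱ-flip : ∀ (w : V → V → ℕ) → ∑ᴱ (λ u v → w v u) ≡ ∑ᴱ w
  ∑ᴱ-flip w = trans (∑-comm (λ u v → b2n (adj X u v) * w v u))
    (sum-cong-≗ λ v → sum-cong-≗ λ u → cong (λ e → b2n e * w v u) (Graph.sym X u v))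

  ∑ᴱ-+-sym : ∀ (w₀ w : V → V → ℕ) →
    ∑ᴱ (λ u v → w₀ u v + (w u v + w v u)) ≡ ∑ᴱ w₀ + (∑ᴱ w + ∑ᴱ w)
  ∑ᴱ-+-sym w₀ w = begin
    ∑ᴱ (λ u v → w₀ u v + (w u v + w v u))              ≡⟨ ∑ᴱ-distrib-+ w₀ _ ⟩
    ∑ᴱ w₀ + ∑ᴱ (λ u v → w u v + w v u)                 ≡⟨ cong (∑ᴱ w₀ +_) (∑ᴱ-distrib-+ w _) ⟩
    ∑ᴱ w₀ + (∑ᴱ w + ∑ᴱ (λ u v → w v u))                ≡⟨ cong (λ e → ∑ᴱ w₀ + (∑ᴱ w + e)) (∑ᴱ-flip w) ⟩
    ∑ᴱ w₀ + (∑ᴱ w + ∑ᴱ w)                              ∎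
    where open ≡-Reasoning

  ∑ᴱ-sum : ∀ {k} (w : Fin k → V → V → ℕ) → ∑ᴱ (λ u v → sum λ j → w j u v) ≡ sum (λ j → ∑ᴱ (w j))
  ∑ᴱ-sum w = begin
    ∑ᴱ (λ u v → sum λ j → w j u v)
      ≡⟨ sum-cong-≗ (λ u → sum-cong-≗ λ v → *-distribˡ-sum (b2n (adj X u v)) (λ j → w j u v)) ⟩
    sum (λ u → sum λ v → sum λ j → b2n (adj X u v) * w j u v)
      ≡⟨ sum-cong-≗ (λ u → ∑-comm (λ v j → b2n (adj X u v) * w j u v)) ⟩
    sum (λ u → sum λ j → sum λ v → b2n (adj X u v) * w j u v)
      ≡⟨ ∑-comm (λ u j → sum λ v → b2n (adj X u v) * w j u v) ⟩
    sum (λ j → ∑ᴱ (w j)) ∎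
    where open ≡-Reasoning

  ∑ᴱ-zero : ∑ᴱ (λ _ _ → 0) ≡ 0
  ∑ᴱ-zero = begin
    ∑ᴱ (λ _ _ → 0)                        ≡⟨ sum-cong-≗ (λ u → sum-cong-≗ λ v → *-zeroʳ (b2n (adj X u v))) ⟩
    sum {n X} (λ _ → sum {n X} λ _ → 0)   ≡⟨ sum-cong-≗ {n X} (λ _ → sum-zero (n X)) ⟩
    sum {n X} (λ _ → 0)                   ≡⟨ sum-zero (n X) ⟩
    0                                     ∎
    where open ≡-Reasoning

  ∑ᴱ-≤-square : ∀ (w : V → V → ℕ) → (∀ u v → w u v ≤ 1) → ∑ᴱ w ≤ n X * n X
  ∑ᴱ-≤-square w w≤1 = begin
    ∑ᴱ w                                  ≤⟨ sum-mono-≤ (λ u → sum-mono-≤ λ v → b2n-adj≤1 u v) ⟩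
    sum {n X} (λ _ → sum {n X} λ _ → 1)   ≡⟨ sum-cong-≗ {n X} (λ _ → card-full (n X)) ⟩
    sum {n X} (λ _ → n X)                 ≡⟨ sum-const (n X) (n X) ⟩
    n X * n X                             ∎
    where
    open ≤-Reasoning
    b2n-adj≤1 : ∀ u v → b2n (adj X u v) * w u v ≤ 1
    b2n-adj≤1 u v with adj X u v
    ... | false = z≤n
    ... | true  = ≤-trans (≤-reflexive (+-identityʳ (w u v))) (w≤1 u v)

  ∂[_]_ : (V → Bool) → (V → Bool) → ℕ
  ∂[ S ] A = ∑ᴱ λ u v → b2n (A u ∧ not (A v) ∧ S v)

  ∂-self : ∀ (S : V → Bool) → ∂[ S ] S ≡ 0
  ∂-self S = trans (∑ᴱ-cong λ u v → leaving (S u) (S v)) ∑ᴱ-zero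
    where
    leaving : ∀ x y → b2n (x ∧ not y ∧ y) ≡ 0
    leaving false _     = refl
    leaving true  false = refl
    leaving true  true  = refl

  ∂-cong : ∀ {S S′ A A′ : V → Bool} → (∀ v → S v ≡ S′ v) → (∀ v → A v ≡ A′ v) → ∂[ S ] A ≡ ∂[ S′ ] A′
  ∂-cong S≗S′ A≗A′ = ∑ᴱ-cong λ u v →
    cong₂ (λ x y → b2n (x ∧ y)) (A≗A′ u) (cong₂ (λ x y → not x ∧ y) (A≗A′ v) (S≗S′ v))

  ∂in≡∂ : ∀ (S A : Subset (n X)) → ∂in X S A ≡ ∂[ lookup S ] (lookup A)
  ∂in≡∂ S A = trans (∑≡sum {n X} _) (sum-cong-≗ λ u → trans (∑≡sum {n X} _) (sum-cong-≗ λ v →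
    b2n-∧ (adj X u v) (lookup A u ∧ not (lookup A v) ∧ lookup S v)))

  ∂-∪≤ : ∀ (T P Q : V → Bool) → ∂[ T ] (λ v → P v ∨ Q v) ≤ ∂[ T ] P + ∂[ (λ v → not (P v) ∧ T v) ] Q
  ∂-∪≤ T P Q = ≤-trans (∑ᴱ-mono-≤ λ u v → leaving (P u) (Q u) (P v) (Q v) (T v))
                       (≤-reflexive (∑ᴱ-distrib-+ _ _))
    where
    leaving : ∀ p₁ q₁ p₂ q₂ t →
      b2n ((p₁ ∨ q₁) ∧ not (p₂ ∨ q₂) ∧ t) ≤ b2n (p₁ ∧ not p₂ ∧ t) + b2n (q₁ ∧ not q₂ ∧ not p₂ ∧ t)
    leaving false false _     _     _ = z≤n
    leaving true  _     true  _     _ = z≤n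
    leaving true  _     false true  _ = z≤n
    leaving true  _     false false t = m≤m+n (b2n t) _
    leaving false true  true  _     _ = z≤n
    leaving false true  false _     _ = ≤-refl

module Labellings (X : Graph) where

  open Counting
  open EdgeCounts X

  open import Data.Nat hiding (_≟_)
  open import Data.Nat.Properties hiding (_≟_)
  open import Data.Bool using (Bool; true; false; _∧_; not; if_then_else_)
  open import Data.Bool.Properties using (∧-identityʳ)
  open import Data.Fin using (Fin; zero; suc; punchIn)
  open import Data.Fin.Properties using (_≟_)
  open import Data.Vec using (lookup)
  open import Data.Vec.Properties using (lookup∘tabulate)
  open import Function using (_∘_; _∋_)
  open import Relation.Nullary using (does; yes; no)
  open import Relation.Nullary.Decidable using (dec-true; does-≡; map′)
  open import Relation.Binary.PropositionalEquality
  open import Algebra.Properties.Semiring.Sum +-*-semiring using (sum; sum-cong-≗; ∑-comm)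

  Labelling : ℕ → Set
  Labelling k = V → Fin (suc k)

  isBlockLabel : ∀ {k} → Fin (suc k) → Bool
  isBlockLabel zero    = false
  isBlockLabel (suc _) = true

  separated : ∀ {k} → Fin (suc k) → Fin (suc k) → Bool
  separated zero    _       = false
  separated (suc _) zero    = false
  separated (suc s) (suc t) = not (does (s ≟ t))

  block : ∀ {k} → Labelling k → Fin k → V → Bool
  block ℓ i v = does (ℓ v ≟ suc i)

  cut : ∀ {k} → Labelling k → ℕ
  cut ℓ = ∑ᴱ λ u v → b2n (separated (ℓ u) (ℓ v))

  relabel : ∀ {k} → Labelling k → (V → Bool) → Fin k → Labelling k
  relabel ℓ A j v = if A v then suc j else ℓ v

  lift : ∀ {k} → Labelling k → Labelling (suc k)
  lift ℓ = punchIn (suc zero) ∘ ℓ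

  private
    does-≟-comm : ∀ {k} (s t : Fin k) → does (s ≟ t) ≡ does (t ≟ s)
    does-≟-comm s t = does-≡ (map′ sym sym (s ≟ t)) (t ≟ s)

    b2n-not+b2n : ∀ b → b2n (not b) + b2n b ≡ 1
    b2n-not+b2n true  = refl
    b2n-not+b2n false = refl

    separated-refl : ∀ {k} (s : Fin (suc k)) → separated s s ≡ false
    separated-refl zero    = refl
    separated-refl (suc s) = cong not (dec-true (s ≟ s) refl)

    separated-comm : ∀ {k} (s t : Fin (suc k)) → separated s t ≡ separated t s
    separated-comm zero    zero    = refl
    separated-comm zero    (suc t) = refl
    separated-comm (suc s) zero    = refl
    separated-comm (suc s) (suc t) = cong not (does-≟-comm s t)

    separated-+-≟ : ∀ {k} (x : Fin (suc k)) j →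
      b2n (separated x (suc j)) + b2n (does (x ≟ suc j)) ≡ b2n (isBlockLabel x)
    separated-+-≟ zero    j = refl
    separated-+-≟ (suc x) j = b2n-not+b2n (does (x ≟ j))

    -- Relabelling A ⊆ block i to j uncuts the edges from A into block j ∖ A and cuts those from A into
    -- block i ∖ A; every other pair keeps its status.
    relabel-pair : ∀ {k} (i j : Fin k) (a b : Bool) (x y : Fin (suc k)) →
      (a ≡ true → x ≡ suc i) → (b ≡ true → y ≡ suc i) →
      b2n (separated (if a then suc j else x) (if b then suc j else y))
        + (b2n (a ∧ not b ∧ does (y ≟ suc j)) + b2n (b ∧ not a ∧ does (x ≟ suc j)))
      ≡ b2n (separated x y) + (b2n (a ∧ not b ∧ does (y ≟ suc i)) + b2n (b ∧ not a ∧ does (x ≟ suc i)))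
    relabel-pair i j false false x y _ _ = refl
    relabel-pair i j true true x y x≡ y≡
      rewrite x≡ refl | y≡ refl | separated-refl (suc i) | separated-refl (suc j) = refl
    relabel-pair i j true false x y x≡ _ rewrite x≡ refl = begin
      b2n (separated (suc j) y) + (b2n (does (y ≟ suc j)) + 0)
        ≡⟨ cong₂ _+_ (cong b2n (separated-comm (suc j) y)) (+-identityʳ _) ⟩
      b2n (separated y (suc j)) + b2n (does (y ≟ suc j))        ≡⟨ separated-+-≟ y j ⟩
      b2n (isBlockLabel y)                                             ≡⟨ separated-+-≟ y i ⟨
      b2n (separated y (suc i)) + b2n (does (y ≟ suc i))
        ≡⟨ cong₂ _+_ (cong b2n (separated-comm (suc i) y)) (+-identityʳ _) ⟨
      b2n (separated (suc i) y) + (b2n (does (y ≟ suc i)) + 0)  ∎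
      where open ≡-Reasoning
    relabel-pair i j false true x y _ y≡ rewrite y≡ refl =
      trans (separated-+-≟ x j) (sym (separated-+-≟ x i))

  relabel-cut : ∀ {k} (ℓ : Labelling k) (A : V → Bool) (i j : Fin k) → (∀ v → A v ≡ true → ℓ v ≡ suc i) →
    cut (relabel ℓ A j) + (∂[ block ℓ j ] A + ∂[ block ℓ j ] A)
      ≡ cut ℓ + (∂[ block ℓ i ] A + ∂[ block ℓ i ] A)
  relabel-cut ℓ A i j A⊆i = begin
    cut ℓ′ + (∂[ block ℓ j ] A + ∂[ block ℓ j ] A)  ≡⟨ ∑ᴱ-+-sym (separatedᴱ ℓ′) (towards j) ⟨
    ∑ᴱ (λ u v → b2n (separated (ℓ′ u) (ℓ′ v)) + (towards j u v + towards j v u))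
      ≡⟨ ∑ᴱ-cong (λ u v → relabel-pair i j (A u) (A v) (ℓ u) (ℓ v) (A⊆i u) (A⊆i v)) ⟩
    ∑ᴱ (λ u v → b2n (separated (ℓ u) (ℓ v)) + (towards i u v + towards i v u))
      ≡⟨ ∑ᴱ-+-sym (separatedᴱ ℓ) (towards i) ⟩
    cut ℓ + (∂[ block ℓ i ] A + ∂[ block ℓ i ] A)  ∎
    where
    open ≡-Reasoning
    ℓ′ = relabel ℓ A j
    separatedᴱ : Labelling _ → V → V → ℕ
    separatedᴱ ℓ₁ u v = b2n (separated (ℓ₁ u) (ℓ₁ v))
    towards : Fin _ → V → V → ℕ
    towards t u v = b2n (A u ∧ not (A v) ∧ block ℓ t v)

  isBlockLabel-relabel : ∀ {k} (ℓ : Labelling k) (A : V → Bool) {i} j → (∀ v → A v ≡ true → ℓ v ≡ suc i) →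
    ∀ v → isBlockLabel (relabel ℓ A j v) ≡ isBlockLabel (ℓ v)
  isBlockLabel-relabel ℓ A j A⊆i v with A v in Av
  ... | true  = cong isBlockLabel (sym (A⊆i v Av))
  ... | false = refl

  isBlockLabel≡false : ∀ {k} {x : Fin (suc k)} → isBlockLabel x ≡ false → x ≡ zero
  isBlockLabel≡false {x = zero}  _  = refl
  isBlockLabel≡false {x = suc _} ()

  -- Defs.part tests labels with a Boolean equality on Fin that is local to a where-block, so it cannot
  -- be named. The underscore below is solved by unification to that test (the with-generalisation
  -- makes the unification problem a pattern), after which it computes by its defining clauses.
  private mutual
    partTest : (k : ℕ) → Labelling k → Fin k → Fin k → ∀ {m} → Fin m → Fin m → Bool
    partTest = _

    lookup-part-suc-suc : ∀ {k} (ℓ : Labelling (suc k)) (a b : Fin k) v → ℓ v ≡ suc (suc a) →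
      lookup (part X ℓ (suc b)) v ≡ partTest (suc k) ℓ (suc a) (suc b) a b
    lookup-part-suc-suc {k} ℓ a b v ℓv≡
      with ℓ v | (lookup (part X ℓ (suc b)) v ≡ _ ∋ lookup∘tabulate _ v) | ℓv≡
    ... | _ | eq | refl with suc k | ℓ | suc a | suc b | eq
    ... | _ | _ | _ | _ | eq′ = eq′

    partTest-correct : ∀ k ℓ (j i : Fin k) {m} (a b : Fin m) → partTest k ℓ j i a b ≡ does (a ≟ b)
    partTest-correct k ℓ j i zero    zero    = refl
    partTest-correct k ℓ j i zero    (suc b) = refl
    partTest-correct k ℓ j i (suc a) zero    = refl
    partTest-correct k ℓ j i (suc a) (suc b) = partTest-correct k ℓ j i a b

  lookup-part : ∀ {k} (ℓ : Labelling k) i v → lookup (part X ℓ i) v ≡ block ℓ i v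
  lookup-part ℓ i v with ℓ v in ℓv | (lookup (part X ℓ i) v ≡ _ ∋ lookup∘tabulate _ v)
  lookup-part ℓ i       v | zero        | eq = eq
  lookup-part ℓ zero    v | suc zero    | eq = eq
  lookup-part ℓ (suc b) v | suc zero    | eq = eq
  lookup-part ℓ zero    v | suc (suc a) | eq = eq
  lookup-part ℓ (suc b) v | suc (suc a) | _  =
    trans (lookup-part-suc-suc ℓ a b v ℓv) (partTest-correct _ ℓ (suc a) (suc b) a b)

  ∣part∣≡card-block : ∀ {k} (ℓ : Labelling k) i → ∣ part X ℓ i ∣ ≡ card (block ℓ i)
  ∣part∣≡card-block ℓ i = trans (∣∣≡card (part X ℓ i)) (card-cong (lookup-part ℓ i))

  block-label : ∀ {k} (ℓ : Labelling k) {i v} → block ℓ i v ≡ true → ℓ v ≡ suc i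
  block-label ℓ {i} {v} in-block with ℓ v ≟ suc i
  ... | yes ℓv≡i = ℓv≡i
  ... | no  _    with () ← in-block

  block-relabel-outside : ∀ {k} (ℓ : Labelling k) (A : V → Bool) j j′ v → A v ≡ false →
    block (relabel ℓ A j) j′ v ≡ block ℓ j′ v
  block-relabel-outside ℓ A j j′ v Av≡false rewrite Av≡false = refl

  isBlockLabel-lift : ∀ {k} (ℓ : Labelling k) v → isBlockLabel (lift ℓ v) ≡ isBlockLabel (ℓ v)
  isBlockLabel-lift ℓ v with ℓ v
  ... | zero  = refl
  ... | suc _ = refl

  block-lift : ∀ {k} (ℓ : Labelling k) i v → block (lift ℓ) (suc i) v ≡ block ℓ i v
  block-lift ℓ i v with ℓ v
  ... | zero  = refl
  ... | suc _ = refl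

  block-lift-zero : ∀ {k} (ℓ : Labelling k) v → block (lift ℓ) zero v ≡ false
  block-lift-zero ℓ v with ℓ v
  ... | zero  = refl
  ... | suc _ = refl

  cut-lift : ∀ {k} (ℓ : Labelling k) → cut (lift ℓ) ≡ cut ℓ
  cut-lift ℓ = ∑ᴱ-cong λ u v → cong b2n (separated-punchIn (ℓ u) (ℓ v))
    where
    separated-punchIn : ∀ {k} (x y : Fin (suc k)) →
      separated (punchIn (suc zero) x) (punchIn (suc zero) y) ≡ separated x y
    separated-punchIn zero    _       = refl
    separated-punchIn (suc _) zero    = refl
    separated-punchIn (suc _) (suc _) = refl

  cut≤square : ∀ {k} (ℓ : Labelling k) → cut ℓ ≤ n X * n X
  cut≤square ℓ = ∑ᴱ-≤-square _ λ u v → b2n≤1 (separated (ℓ u) (ℓ v))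

  ∂-block≤cut : ∀ {k} (ℓ : Labelling k) i → ∂[ isBlockLabel ∘ ℓ ] (block ℓ i) ≤ cut ℓ
  ∂-block≤cut ℓ i = ∑ᴱ-mono-≤ λ u v → leaving (ℓ u) (ℓ v)
    where
    leaving : ∀ x y → b2n (does (x ≟ suc i) ∧ not (does (y ≟ suc i)) ∧ isBlockLabel y) ≤ b2n (separated x y)
    leaving x y with x ≟ suc i
    ... | no _ = z≤n
    leaving _ zero    | yes refl = z≤n
    leaving _ (suc t) | yes refl =
      ≤-reflexive (cong b2n (trans (∧-identityʳ _) (cong not (does-≟-comm t i))))

  private
    sum-≟ : ∀ {k} (s : Fin k) → sum (λ j → b2n (does (s ≟ j))) ≡ 1
    sum-≟ {suc k} zero    = cong suc (sum-zero k)
    sum-≟ {suc k} (suc s) = sum-≟ s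

    sum-≟-suc : ∀ {k} (x : Fin (suc k)) → sum (λ j → b2n (does (x ≟ suc j))) ≡ b2n (isBlockLabel x)
    sum-≟-suc {k} zero = sum-zero k
    sum-≟-suc (suc s)  = sum-≟ s

  ∂-isBlockLabel≡∑∂-block : ∀ {k} (ℓ : Labelling k) A → ∂[ isBlockLabel ∘ ℓ ] A ≡ sum λ j → ∂[ block ℓ j ] A
  ∂-isBlockLabel≡∑∂-block {k} ℓ A =
    trans (∑ᴱ-cong λ u v → by-block (A u) (A v) (ℓ v)) (∑ᴱ-sum λ j u v → b2n (A u ∧ not (A v) ∧ block ℓ j v))
    where
    by-block : ∀ a b x → b2n (a ∧ not b ∧ isBlockLabel x) ≡ sum λ j → b2n (a ∧ not b ∧ does (x ≟ suc j))
    by-block false _     _ = sym (sum-zero k)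
    by-block true  true  _ = sym (sum-zero k)
    by-block true  false x = sym (sum-≟-suc x)

  ∑-card-block≤ : ∀ {k} (ℓ : Labelling k) → sum (λ i → card (block ℓ i)) ≤ n X
  ∑-card-block≤ ℓ = begin
    sum (λ i → card (block ℓ i))               ≡⟨ ∑-comm (λ i v → b2n (block ℓ i v)) ⟩
    sum (λ v → sum λ i → b2n (block ℓ i v))    ≡⟨ sum-cong-≗ (sum-≟-suc ∘ ℓ) ⟩
    card (isBlockLabel ∘ ℓ)                          ≤⟨ card≤ (isBlockLabel ∘ ℓ) ⟩
    n X                                        ∎
    where open ≤-Reasoning


module Maximality (X : Graph) (ε : ℚ) (F : Subset (n X)) (F-max : IsMaximalFolner X ε F) where

  open Counting
  open RationalBounds using (≤*ℕ→ℚ-+)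
  open EdgeCounts X

  open import Data.Nat
  open import Data.Nat.Properties
  open import Data.Bool using (Bool; true; false; _∧_; _∨_; not)
  open import Data.Bool.Properties using (∧-identityʳ; ∨-zeroʳ)
  open import Data.Fin.Subset using (_∈_)
  open import Data.Vec using (lookup; tabulate)
  open import Data.Vec.Properties using (lookup∘tabulate; []=⇒lookup; lookup⇒[]=)
  open import Data.Product using (∃; _,_; proj₁; proj₂)
  open import Relation.Nullary using (yes; no; contradiction)
  open import Relation.Binary.PropositionalEquality

  Y : V → Bool
  Y v = not (lookup F v)

  private
    ∈-tabulate : ∀ {p : V → Bool} {v} → p v ≡ true → v ∈ tabulate p
    ∈-tabulate {p} {v} pv = lookup⇒[]= v (tabulate p) (trans (lookup∘tabulate p v) pv)

    F∪ : (V → Bool) → Subset (n X)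
    F∪ S = tabulate λ v → lookup F v ∨ S v

    lookup-full : ∀ v → lookup (full X) v ≡ true
    lookup-full = lookup∘tabulate {n = n X} (λ _ → true)

    ∣full∣ : ∣ full X ∣ ≡ n X
    ∣full∣ = trans (∣∣≡card (full X)) (trans (card-cong lookup-full) (card-full (n X)))

    module _ (S : V → Bool) (S⊆Y : ∀ v → S v ≡ true → Y v ≡ true) where

      lookup-F∪S : ∀ v → lookup (F∪ S) v ≡ lookup F v ∨ S v
      lookup-F∪S = lookup∘tabulate (λ v → lookup F v ∨ S v)

      disjoint : ∀ v → lookup F v ≡ true → S v ≡ false
      disjoint v Fv with S v in Sv
      ... | false = refl
      ... | true  with () ← trans (sym (cong not Fv)) (S⊆Y v Sv)

      ∣F∪S∣ : ∣ F∪ S ∣ ≡ ∣ F ∣ + card S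
      ∣F∪S∣ = begin
        ∣ F∪ S ∣                          ≡⟨ ∣∣≡card (F∪ S) ⟩
        card (lookup (F∪ S))              ≡⟨ card-cong lookup-F∪S ⟩
        card (λ v → lookup F v ∨ S v)     ≡⟨ card-∨ (lookup F) S disjoint ⟩
        card (lookup F) + card S          ≡⟨ cong (_+ card S) (∣∣≡card F) ⟨
        ∣ F ∣ + card S                    ∎
        where open ≡-Reasoning

      ∂F∪S≤ : ∂in X (full X) (F∪ S) ≤ ∂in X (full X) F + ∂[ Y ] S
      ∂F∪S≤ = begin
        ∂in X (full X) (F∪ S)                                      ≡⟨ ∂in≡∂ (full X) (F∪ S) ⟩
        ∂[ lookup (full X) ] (lookup (F∪ S))                       ≡⟨ ∂-cong (λ _ → refl) lookup-F∪S ⟩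
        ∂[ lookup (full X) ] (λ v → lookup F v ∨ S v)              ≤⟨ ∂-∪≤ (lookup (full X)) (lookup F) S ⟩
        ∂[ lookup (full X) ] (lookup F) + ∂[ (λ v → Y v ∧ lookup (full X) v) ] S
          ≡⟨ cong₂ _+_ (∂in≡∂ (full X) F) (∂-cong {A = S} Y≡Y∧full (λ _ → refl)) ⟨
        ∂in X (full X) F + ∂[ Y ] S                                ∎
        where
        open ≤-Reasoning
        Y≡Y∧full : ∀ v → Y v ≡ Y v ∧ lookup (full X) v
        Y≡Y∧full v = sym (trans (cong (Y v ∧_) (lookup-full v)) (∧-identityʳ (Y v)))

      S⊆F∪S : ∀ {v} → S v ≡ true → v ∈ F∪ S
      S⊆F∪S {v} Sv = ∈-tabulate (trans (cong (lookup F v ∨_) Sv) (∨-zeroʳ (lookup F v)))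

      F⊆F∪S : ∀ {v} → v ∈ F → v ∈ F∪ S
      F⊆F∪S {v} v∈F = ∈-tabulate (cong (_∨ S v) ([]=⇒lookup v∈F))

      F∪S-Folner : ∃ (λ v → S v ≡ true) → ℕ→ℚ (∂[ Y ] S) ℚ.≤ ε ℚ.* ℕ→ℚ (card S) →
        2 * (∣ F ∣ + card S) ≤ n X → IsFolner X ε (F∪ S)
      F∪S-Folner (v₀ , Sv₀) ∂S≤ε|S| small =
          (λ {v} _ → lookup⇒[]= v (full X) (lookup-full v))
        , (v₀ , S⊆F∪S Sv₀)
        , subst₂ _≤_ (cong (2 *_) (sym ∣F∪S∣)) (sym ∣full∣) small
        , subst (λ m → ℕ→ℚ (∂in X (full X) (F∪ S)) ℚ.≤ ε ℚ.* ℕ→ℚ m) (sym ∣F∪S∣)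
            (≤*ℕ→ℚ-+ ε {x = ∂in X (full X) F} {∂[ Y ] S} {∣ F ∣} {card S}
              ∂F∪S≤ (proj₂ (proj₂ (proj₂ (proj₁ F-max)))) ∂S≤ε|S|)

  maximal⇒union-large : ∀ (S : V → Bool) → (∀ v → S v ≡ true → Y v ≡ true) → ∃ (λ v → S v ≡ true) →
    ℕ→ℚ (∂[ Y ] S) ℚ.≤ ε ℚ.* ℕ→ℚ (card S) → n X < 2 * (∣ F ∣ + card S)
  maximal⇒union-large S S⊆Y (v₀ , Sv₀) ∂S≤ε|S| with 2 * (∣ F ∣ + card S) ≤? n X
  ... | no  large = ≰⇒> large
  ... | yes small = contradiction (trans (sym Sv₀) (disjoint S S⊆Y v₀ ([]=⇒lookup v₀∈F))) λ ()
    where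
    v₀∈F : v₀ ∈ F
    v₀∈F = proj₂ F-max (F∪ S) (F∪S-Folner S S⊆Y (v₀ , Sv₀) ∂S≤ε|S| small) (F⊆F∪S S S⊆Y) (S⊆F∪S S S⊆Y Sv₀)

module Refinement
  (X : Graph) (ε : ℚ) (F : Subset (n X)) (F-max : IsMaximalFolner X ε F)
  (a : ℕ) (a-bound : ∀ {e s} → a ℕ.* e ℕ.≤ s → ℕ→ℚ e ℚ.≤ ε ℚ.* ℕ→ℚ s)
  (c : ℕ) (F-small : 2 ℕ.* (n X ℕ.+ c ℕ.* ∣ F ∣) ℕ.< c ℕ.* n X)
  where

  open Counting
  open RationalBounds using (1/suc; ≤-1/suc-*⇒)
  open Arithmetic
  open Descent
  open EdgeCounts X
  open Labellings X
  open Maximality X ε F F-max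

  open import Data.Nat hiding (_≟_)
  open import Data.Nat.Properties hiding (_≟_; suc-injective)
  open import Data.Nat.Tactic.RingSolver using (solve; solve-∀)
  open import Data.List using ([]; _∷_)
  open import Data.Bool using (Bool; true; false; _∧_; not; if_then_else_)
  import Data.Bool as Bool
  open import Data.Bool.Properties using (∧-conicalˡ; ∧-conicalʳ; not-injective)
  open import Data.Fin using (Fin; zero; suc; punchIn)
  open import Data.Fin.Properties using (_≟_; any?; all?; suc-injective)
  open import Data.Fin.Subset using (_∈_)
  open import Data.Fin.Subset.Properties using (anySubset?)
  open import Data.Vec using (lookup)
  open import Data.Vec.Properties using ([]=⇒lookup; lookup⇒[]=)
  open import Data.Product using (Σ; ∃; _×_; _,_; proj₁; proj₂)
  open import Data.Sum using (_⊎_; inj₁; inj₂)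
  open import Function using (_∘_)
  open import Function.Bundles using (_⇔_; mk⇔)
  open import Relation.Nullary using (¬_; Dec; yes; no; contradiction)
  open import Relation.Nullary.Decidable using (_×-dec_; _→-dec_)
  open import Relation.Binary.PropositionalEquality
  open import Algebra.Properties.Semiring.Sum +-*-semiring using (sum; *-distribˡ-sum)
  open import Algebra.Properties.CommutativeSemigroup *-commutativeSemigroup using (x∙yz≈y∙xz)

  N : ℕ
  N = n X

  M : ℕ
  M = suc (4 * a * c * c)

  IsFolnerᴹ : (V → Bool) → (V → Bool) → Set
  IsFolnerᴹ S A =
    (∀ v → A v ≡ true → S v ≡ true) × ∃ (λ v → A v ≡ true) × 2 * card A ≤ card S × M * ∂[ S ] A ≤ card A

  IsFolnerᴹ? : ∀ S A → Dec (IsFolnerᴹ S A)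
  IsFolnerᴹ? S A =
    all? (λ v → (A v Bool.≟ true) →-dec (S v Bool.≟ true)) ×-dec
    any? (λ v → A v Bool.≟ true) ×-dec
    2 * card A ≤? card S ×-dec
    M * ∂[ S ] A ≤? card A

  record Valid {k} (ℓ : Labelling k) : Set where
    field
      Y-labels  : ∀ v → Y v ≡ isBlockLabel (ℓ v)
      nonempty  : ∀ i → ∃ λ v → block ℓ i v ≡ true
      isolated  : ∀ i → a * ∂[ Y ] (block ℓ i) ≤ card (block ℓ i)
      cut-bound : M * cut ℓ ≤ 2 * k * N

  open Valid

  c-positive : 0 < c
  c-positive = 0<-factorˡ F-small

  isolation : ∀ {e D b} → e ≤ D → M * D ≤ 2 * c * N → N < 2 * c * b → a * e ≤ b
  isolation {e} {D} {b} e≤D MD≤2cN N<2cb = *-cancelˡ-≤ M (begin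
    M * (a * e)              ≡⟨ x∙yz≈y∙xz M a e ⟩
    a * (M * e)              ≤⟨ *-monoʳ-≤ a (*-monoʳ-≤ M e≤D) ⟩
    a * (M * D)              ≤⟨ *-monoʳ-≤ a MD≤2cN ⟩
    a * (2 * c * N)          ≤⟨ *-monoʳ-≤ a (*-monoʳ-≤ (2 * c) (<⇒≤ N<2cb)) ⟩
    a * (2 * c * (2 * c * b)) ≡⟨ solve (a ∷ c ∷ b ∷ []) ⟩
    4 * a * c * c * b        ≤⟨ *-monoˡ-≤ b (n≤1+n (4 * a * c * c)) ⟩
    M * b                    ∎)
    where open ≤-Reasoning

  ∂Y-block≤cut : ∀ {k} (ℓ : Labelling k) → (∀ v → Y v ≡ isBlockLabel (ℓ v)) → ∀ i → ∂[ Y ] (block ℓ i) ≤ cut ℓ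
  ∂Y-block≤cut ℓ Y-labels′ i =
    ≤-trans (≤-reflexive (∂-cong {A = block ℓ i} Y-labels′ (λ _ → refl))) (∂-block≤cut ℓ i)

  large-block-isolated : ∀ {k} (ℓ : Labelling k) → (∀ v → Y v ≡ isBlockLabel (ℓ v)) → M * cut ℓ ≤ 2 * c * N →
    ∀ i → N < 2 * c * card (block ℓ i) → a * ∂[ Y ] (block ℓ i) ≤ card (block ℓ i)
  large-block-isolated ℓ Y-labels′ cut-bound′ i = isolation (∂Y-block≤cut ℓ Y-labels′ i) cut-bound′

  large-block-nonempty : ∀ {B : V → Bool} → N < 2 * c * card B → ∃ λ v → B v ≡ true
  large-block-nonempty {B} N<2cB = card-nonempty B (0<-factorʳ {y = 2 * c} N<2cB)

  module _ {k} {ℓ : Labelling k} (valid : Valid ℓ) where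

    block-large : ∀ i → N < 2 * (∣ F ∣ + card (block ℓ i))
    block-large i = maximal⇒union-large (block ℓ i) inside-Y (nonempty valid i) (a-bound (isolated valid i))
      where
      inside-Y : ∀ v → block ℓ i v ≡ true → Y v ≡ true
      inside-Y v in-block = trans (Y-labels valid v) (cong isBlockLabel (block-label ℓ in-block))

    block-large′ : ∀ i → N < c * card (block ℓ i)
    block-large′ i = fraction-gap {c = c} {∣ F ∣} {card (block ℓ i)} F-small (block-large i)

  blocks<c : ∀ {k} {ℓ : Labelling k} → Valid ℓ → k < c
  blocks<c {zero}  _ = c-positive
  blocks<c {suc k} {ℓ} valid = ≰⇒> λ c≤1+k → <-irrefl refl (begin-strict
    suc k * N                          ≡⟨ sum-const (suc k) N ⟨
    sum {suc k} (λ _ → N)              <⟨ sum-mono-< (block-large′ valid) ⟩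
    sum (λ i → c * card (block ℓ i))   ≡⟨ *-distribˡ-sum c (λ i → card (block ℓ i)) ⟨
    c * sum (λ i → card (block ℓ i))   ≤⟨ *-monoʳ-≤ c (∑-card-block≤ ℓ) ⟩
    c * N                              ≤⟨ *-monoˡ-≤ N c≤1+k ⟩
    suc k * N                          ∎)
    where open ≤-Reasoning

  module Step {k} {ℓ : Labelling k} (valid : Valid ℓ) {i : Fin k} {A : V → Bool}
              (A-Folner : IsFolnerᴹ (block ℓ i) A) where

    A⊆i : ∀ v → A v ≡ true → ℓ v ≡ suc i
    A⊆i v Av = block-label ℓ (proj₁ A-Folner v Av)

    ∂ᵢ : ℕ
    ∂ᵢ = ∂[ block ℓ i ] A

    M∂ᵢ≤|A| : M * ∂ᵢ ≤ card A
    M∂ᵢ≤|A| = proj₂ (proj₂ (proj₂ A-Folner))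

    A-halves-block : ∀ j → 2 * card (λ v → block ℓ j v ∧ A v) ≤ card (block ℓ j)
    A-halves-block j with j ≟ i
    ... | yes refl = ≤-trans (*-monoʳ-≤ 2 (card-mono λ v → ∧-conicalʳ _ (A v)))
                             (proj₁ (proj₂ (proj₂ A-Folner)))
    ... | no  j≢i  = subst (λ x → 2 * x ≤ card (block ℓ j)) (sym no-overlap) z≤n
      where
      disjoint : ∀ v → (block ℓ j v ∧ A v) ≡ true → false ≡ true
      disjoint v jv∧Av = contradiction (suc-injective (trans (sym (block-label ℓ (∧-conicalˡ _ _ jv∧Av)))
                                                              (A⊆i v (∧-conicalʳ _ _ jv∧Av)))) j≢i
      no-overlap : card (λ v → block ℓ j v ∧ A v) ≡ 0
      no-overlap = n≤0⇒n≡0 (≤-trans (card-mono {q = λ _ → false} disjoint) (≤-reflexive (sum-zero N)))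

    shrunk-block-large : ∀ j (B : V → Bool) → (∀ v → block ℓ j v ≡ true → A v ≡ false → B v ≡ true) →
      N < 2 * c * card B
    shrunk-block-large j B kept = begin-strict
      N                        <⟨ block-large′ valid j ⟩
      c * card (block ℓ j)     ≤⟨ *-monoʳ-≤ c (halving {y = card B} |block|≤ (A-halves-block j)) ⟩
      c * (2 * card B)         ≡⟨ trans (x∙yz≈y∙xz c 2 (card B)) (sym (*-assoc 2 c (card B))) ⟩
      2 * c * card B           ∎
      where
      open ≤-Reasoning
      |block|≤ : card (block ℓ j) ≤ card B + card (λ v → block ℓ j v ∧ A v)
      |block|≤ = begin
        card (block ℓ j)     ≡⟨ card-split (block ℓ j) A ⟩
        card (λ v → block ℓ j v ∧ not (A v)) + card (λ v → block ℓ j v ∧ A v)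
          ≤⟨ +-monoˡ-≤ _ (card-mono λ v jv∧¬Av →
               kept v (∧-conicalˡ _ _ jv∧¬Av) (not-injective {y = false} (∧-conicalʳ _ _ jv∧¬Av))) ⟩
        card B + card (λ v → block ℓ j v ∧ A v) ∎

    module Move (j : Fin k) (∂ᵢ<∂ⱼ : ∂ᵢ < ∂[ block ℓ j ] A) where

      ℓ′ : Labelling k
      ℓ′ = relabel ℓ A j

      cut-decreases : cut ℓ′ < cut ℓ
      cut-decreases = +-cancelʳ-< (∂ᵢ + ∂ᵢ) (cut ℓ′) (cut ℓ) (begin-strict
        cut ℓ′ + (∂ᵢ + ∂ᵢ)                               <⟨ +-monoʳ-< (cut ℓ′) (+-mono-< ∂ᵢ<∂ⱼ ∂ᵢ<∂ⱼ) ⟩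
        cut ℓ′ + (∂[ block ℓ j ] A + ∂[ block ℓ j ] A)   ≡⟨ relabel-cut ℓ A i j A⊆i ⟩
        cut ℓ + (∂ᵢ + ∂ᵢ)                                ∎)
        where open ≤-Reasoning

      Y-labels′ : ∀ v → Y v ≡ isBlockLabel (ℓ′ v)
      Y-labels′ v = trans (Y-labels valid v) (sym (isBlockLabel-relabel ℓ A j A⊆i v))

      cut-bound′ : M * cut ℓ′ ≤ 2 * k * N
      cut-bound′ = ≤-trans (*-monoʳ-≤ M (<⇒≤ cut-decreases)) (cut-bound valid)

      large : ∀ j′ → N < 2 * c * card (block ℓ′ j′)
      large j′ = shrunk-block-large j′ (block ℓ′ j′) λ v in-j′ Av≡false →
        trans (block-relabel-outside ℓ A j j′ v Av≡false) in-j′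

      valid′ : Valid ℓ′
      valid′ = record
        { Y-labels  = Y-labels′
        ; nonempty  = large-block-nonempty ∘ large
        ; isolated  = λ j′ → large-block-isolated ℓ′ Y-labels′ cut-bound′′ j′ (large j′)
        ; cut-bound = cut-bound′
        }
        where
        cut-bound′′ : M * cut ℓ′ ≤ 2 * c * N
        cut-bound′′ = ≤-trans cut-bound′ (*-monoˡ-≤ N (*-monoʳ-≤ 2 (<⇒≤ (blocks<c valid))))

    module Split (∂ⱼ≤∂ᵢ : ∀ j → ∂[ block ℓ j ] A ≤ ∂ᵢ) where

      ℓ′ : Labelling (suc k)
      ℓ′ = relabel (lift ℓ) A zero

      A⊆suc-i : ∀ v → A v ≡ true → lift ℓ v ≡ suc (suc i)
      A⊆suc-i v Av = cong (punchIn (suc zero)) (A⊆i v Av)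

      cut-increase : cut ℓ′ ≤ cut ℓ + (∂ᵢ + ∂ᵢ)
      cut-increase = begin
        cut ℓ′                                       ≤⟨ m≤m+n (cut ℓ′) _ ⟩
        cut ℓ′ + (∂[ block (lift ℓ) zero ] A + ∂[ block (lift ℓ) zero ] A)
          ≡⟨ relabel-cut (lift ℓ) A (suc i) zero A⊆suc-i ⟩
        cut (lift ℓ) + (∂[ block (lift ℓ) (suc i) ] A + ∂[ block (lift ℓ) (suc i) ] A)
          ≡⟨ cong₂ (λ x y → x + (y + y)) (cut-lift ℓ) (∂-cong {A = A} (block-lift ℓ i) (λ _ → refl)) ⟩
        cut ℓ + (∂ᵢ + ∂ᵢ)                            ∎
        where open ≤-Reasoning

      cut-bound′ : M * cut ℓ′ ≤ 2 * suc k * N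
      cut-bound′ = begin
        M * cut ℓ′                          ≤⟨ *-monoʳ-≤ M cut-increase ⟩
        M * (cut ℓ + (∂ᵢ + ∂ᵢ))
          ≡⟨ trans (*-distribˡ-+ M (cut ℓ) _) (cong (M * cut ℓ +_) (*-distribˡ-+ M ∂ᵢ ∂ᵢ)) ⟩
        M * cut ℓ + (M * ∂ᵢ + M * ∂ᵢ)       ≤⟨ +-mono-≤ (cut-bound valid) (+-mono-≤ M∂ᵢ≤N M∂ᵢ≤N) ⟩
        2 * k * N + (N + N)                 ≡⟨ one-more-block k N ⟩
        2 * suc k * N                       ∎
        where
        open ≤-Reasoning
        M∂ᵢ≤N : M * ∂ᵢ ≤ N
        M∂ᵢ≤N = ≤-trans M∂ᵢ≤|A| (card≤ A)
        one-more-block : ∀ k N → 2 * k * N + (N + N) ≡ 2 * suc k * N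
        one-more-block = solve-∀

      block-zero : ∀ v → block ℓ′ zero v ≡ A v
      block-zero v with A v
      ... | true  = refl
      ... | false = block-lift-zero ℓ v

      large : ∀ j → N < 2 * c * card (block ℓ′ (suc j))
      large j = shrunk-block-large j (block ℓ′ (suc j)) λ v in-j Av≡false →
        trans (block-relabel-outside (lift ℓ) A zero (suc j) v Av≡false) (trans (block-lift ℓ j v) in-j)

      Y-labels′ : ∀ v → Y v ≡ isBlockLabel (ℓ′ v)
      Y-labels′ v = trans (Y-labels valid v)
        (sym (trans (isBlockLabel-relabel (lift ℓ) A zero A⊆suc-i v) (isBlockLabel-lift ℓ v)))

      A-isolated : a * ∂[ Y ] A ≤ card A
      A-isolated = begin
        a * ∂[ Y ] A                       ≡⟨ cong (a *_) (∂-cong {A = A} (Y-labels valid) (λ _ → refl)) ⟩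
        a * ∂[ isBlockLabel ∘ ℓ ] A              ≡⟨ cong (a *_) (∂-isBlockLabel≡∑∂-block ℓ A) ⟩
        a * sum (λ j → ∂[ block ℓ j ] A)   ≤⟨ *-monoʳ-≤ a (sum-mono-≤ ∂ⱼ≤∂ᵢ) ⟩
        a * sum {k} (λ _ → ∂ᵢ)             ≡⟨ cong (a *_) (sum-const k ∂ᵢ) ⟩
        a * (k * ∂ᵢ)                       ≤⟨ *-monoʳ-≤ a (*-monoˡ-≤ ∂ᵢ (<⇒≤ (blocks<c valid))) ⟩
        a * (c * ∂ᵢ)                       ≡⟨ *-assoc a c ∂ᵢ ⟨
        a * c * ∂ᵢ                         ≤⟨ *-monoˡ-≤ ∂ᵢ ac≤M ⟩
        M * ∂ᵢ                             ≤⟨ M∂ᵢ≤|A| ⟩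
        card A                             ∎
        where
        open ≤-Reasoning
        ac≤M : a * c ≤ M
        ac≤M = begin
          a * c              ≤⟨ m≤m*n (a * c) c {{>-nonZero c-positive}} ⟩
          a * c * c          ≤⟨ m≤n*m (a * c * c) 4 ⟩
          4 * (a * c * c)    ≡⟨ solve (a ∷ c ∷ []) ⟩
          4 * a * c * c      ≤⟨ n≤1+n (4 * a * c * c) ⟩
          M                  ∎

      valid′ : Valid ℓ′
      valid′ = record
        { Y-labels  = Y-labels′
        ; nonempty  = λ
            { zero    → let v , Av = proj₁ (proj₂ A-Folner) in v , trans (block-zero v) Av
            ; (suc j) → large-block-nonempty (large j) }
        ; isolated  = λ
            { zero    → subst₂ (λ x y → a * x ≤ y)
                           (sym (∂-cong (λ _ → refl) block-zero)) (sym (card-cong block-zero)) A-isolated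
            ; (suc j) → large-block-isolated ℓ′ Y-labels′ cut-bound′′ (suc j) (large j) }
        ; cut-bound = cut-bound′
        }
        where
        cut-bound′′ : M * cut ℓ′ ≤ 2 * c * N
        cut-bound′′ = ≤-trans cut-bound′ (*-monoˡ-≤ N (*-monoʳ-≤ 2 (blocks<c valid)))

  State : Set
  State = Σ ℕ λ k → Σ (Labelling k) Valid

  -- Lexicographic in (c ∸ k, cut ℓ), as cut ℓ ≤ N * N.
  μ : State → ℕ
  μ (k , ℓ , _) = (c ∸ k) * suc (N * N) + cut ℓ

  Stable : State → Set
  Stable (k , ℓ , _) = ∀ i (A : Subset N) → ¬ IsFolnerᴹ (block ℓ i) (lookup A)

  move-step : ∀ {k} {ℓ : Labelling k} (valid : Valid ℓ) {i A} (A-Folner : IsFolnerᴹ (block ℓ i) A) j →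
    ∂[ block ℓ i ] A < ∂[ block ℓ j ] A → Σ State λ s′ → μ s′ < μ (k , ℓ , valid)
  move-step {k} valid A-Folner j ∂ᵢ<∂ⱼ =
    (k , ℓ′ , valid′) , +-monoʳ-< ((c ∸ k) * suc (N * N)) cut-decreases
    where open Step.Move valid A-Folner j ∂ᵢ<∂ⱼ

  split-step : ∀ {k} {ℓ : Labelling k} (valid : Valid ℓ) {i A} (A-Folner : IsFolnerᴹ (block ℓ i) A) →
    (∀ j → ∂[ block ℓ j ] A ≤ ∂[ block ℓ i ] A) → Σ State λ s′ → μ s′ < μ (k , ℓ , valid)
  split-step {k} valid A-Folner ∂ⱼ≤∂ᵢ =
    (suc k , ℓ′ , valid′) , lex-< (∸-monoʳ-< (n<1+n k) (blocks<c valid)) (s≤s (cut≤square ℓ′))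
    where open Step.Split valid A-Folner ∂ⱼ≤∂ᵢ

  step : ∀ s → Stable s ⊎ Σ State λ s′ → μ s′ < μ s
  step (k , ℓ , valid) with any? (λ i → anySubset? (λ A → IsFolnerᴹ? (block ℓ i) (lookup A)))
  ... | no  stable = inj₁ λ i A A-Folner → stable (i , A , A-Folner)
  ... | yes (i , A , A-Folner) with any? (λ j → ∂[ block ℓ i ] (lookup A) <? ∂[ block ℓ j ] (lookup A))
  ...   | yes (j , ∂ᵢ<∂ⱼ) = inj₂ (move-step valid A-Folner j ∂ᵢ<∂ⱼ)
  ...   | no  ¬∂ᵢ<∂ⱼ      = inj₂ (split-step valid A-Folner λ j → ≮⇒≥ λ ∂ᵢ<∂ⱼ → ¬∂ᵢ<∂ⱼ (j , ∂ᵢ<∂ⱼ))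

  ℓ₀ : Labelling 1
  ℓ₀ v = if lookup F v then zero else suc zero

  valid₀ : Valid ℓ₀
  valid₀ = record
    { Y-labels  = Y-labels₀
    ; nonempty  = λ { zero → let v , Yv = card-nonempty Y 0<|Y| in v , trans (block₀ v) Yv }
    ; isolated  = λ { zero → ≤-trans (≤-reflexive (trans (cong (a *_) ∂₀≡0) (*-zeroʳ a))) z≤n }
    ; cut-bound = ≤-trans (≤-reflexive (trans (cong (M *_) cut₀) (*-zeroʳ M))) z≤n
    }
    where
    Y-labels₀ : ∀ v → Y v ≡ isBlockLabel (ℓ₀ v)
    Y-labels₀ v with lookup F v
    ... | true  = refl
    ... | false = refl

    block₀ : ∀ v → block ℓ₀ zero v ≡ Y v
    block₀ v with lookup F v
    ... | true  = refl
    ... | false = refl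

    ∂₀≡0 : ∂[ Y ] (block ℓ₀ zero) ≡ 0
    ∂₀≡0 = trans (∂-cong (λ _ → refl) block₀) (∂-self Y)

    cut₀ : cut ℓ₀ ≡ 0
    cut₀ = trans (∑ᴱ-cong λ u v → separated₀ (lookup F u) (lookup F v)) ∑ᴱ-zero
      where
      separated₀ : ∀ x y →
        b2n (separated {1} (if x then zero else suc zero) (if y then zero else suc zero)) ≡ 0
      separated₀ true  _     = refl
      separated₀ false true  = refl
      separated₀ false false = refl

    0<|Y| : 0 < card Y
    0<|Y| = +-cancelʳ-< ∣ F ∣ 0 (card Y) (begin-strict
      ∣ F ∣                         <⟨ proper-part {c = c} F-small ⟩
      N                             ≡⟨ card-full N ⟨
      card {N} (λ _ → true)         ≡⟨ card-split (λ _ → true) (lookup F) ⟩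
      card Y + card (lookup F)      ≡⟨ cong (card Y +_) (∣∣≡card F) ⟨
      card Y + ∣ F ∣                ∎)
      where open ≤-Reasoning

  ∈F⇔label-zero : ∀ {k} {ℓ : Labelling k} → (∀ v → Y v ≡ isBlockLabel (ℓ v)) → ∀ v → (v ∈ F) ⇔ (ℓ v ≡ zero)
  ∈F⇔label-zero {ℓ = ℓ} Y-labels′ v = mk⇔
    (λ v∈F → isBlockLabel≡false (trans (sym (Y-labels′ v)) (cong not ([]=⇒lookup v∈F))))
    (λ ℓv≡0 → lookup⇒[]= v F (not-injective {y = true} (trans (Y-labels′ v) (cong isBlockLabel ℓv≡0))))

  Folner⇒Folnerᴹ : ∀ {k} (ℓ : Labelling k) i A →
    IsFolnerIn X (1/suc (4 * a * c * c)) (part X ℓ i) A → IsFolnerᴹ (block ℓ i) (lookup A)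
  Folner⇒Folnerᴹ ℓ i A (A⊆part , (v , v∈A) , 2|A|≤|part| , ∂≤δ|A|) =
      (λ u Au → trans (sym (lookup-part ℓ i u)) ([]=⇒lookup (A⊆part (lookup⇒[]= u A Au))))
    , (v , []=⇒lookup v∈A)
    , subst₂ (λ x y → 2 * x ≤ y) (∣∣≡card A) (∣part∣≡card-block ℓ i) 2|A|≤|part|
    , subst₂ (λ x y → M * x ≤ y) ∂≡ (∣∣≡card A) (≤-1/suc-*⇒ (4 * a * c * c) ∂≤δ|A|)
    where
    ∂≡ : ∂in X (part X ℓ i) A ≡ ∂[ block ℓ i ] (lookup A)
    ∂≡ = trans (∂in≡∂ (part X ℓ i) A) (∂-cong {A = lookup A} (lookup-part ℓ i) (λ _ → refl))

  refinement : Σ ℕ λ k → Σ (Labelling k) λ ℓ → (∀ v → (v ∈ F) ⇔ (ℓ v ≡ zero)) ×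
    ∀ i → IsExpanderIn X (1/suc (4 * a * c * c)) (part X ℓ i) × N < 2 * (∣ F ∣ + ∣ part X ℓ i ∣)
  refinement with descend μ step (1 , ℓ₀ , valid₀)
  ... | (k , ℓ , valid) , stable = k , ℓ , ∈F⇔label-zero (Y-labels valid) , λ i →
      (λ A A-Folner → stable i A (Folner⇒Folnerᴹ ℓ i A A-Folner))
    , subst (λ m → N < 2 * (∣ F ∣ + m)) (sym (∣part∣≡card-block ℓ i)) (block-large valid i)

open import Data.Nat using (ℕ; suc)
open import Data.Fin using (Fin; zero)
open import Data.Fin.Subset using (Subset; _∈_)
open import Data.Rational using (ℚ; 0ℚ; ½; _<_; _-_)
open import Data.Product using (Σ; _×_; _,_)
open import Relation.Binary.PropositionalEquality using (_≡_)
open import Function.Bundles using (_⇔_)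

open import Data.Nat using (_*_)
open import Data.Nat.Properties using (<⇒≤)
open import Data.Rational using (↧ₙ_)
open import Data.Product using (proj₁; proj₂)
open RationalBounds using (1/suc; 1/suc-positive; denominator-bound; small-fraction; ½-minus-bound)

theorem2p2 : (ε α : ℚ) → 0ℚ < ε → 0ℚ < α → α < ½ →
    Σ ℚ λ δ → 0ℚ < δ ×
      ((X : Graph) (F : Subset (n X)) →
        IsMaximalFolner X ε F → IsSmall X α F →
        Σ ℕ λ k → Σ (Fin (n X) → Fin (suc k)) λ lab →
          (∀ v → (v ∈ F) ⇔ (lab v ≡ zero)) ×
          (∀ i → IsExpanderIn X δ (part X lab i) × IsBig X (½ - α) (part X lab i)))
theorem2p2 ε α 0<ε 0<α α<½ = 1/suc (4 * a * c * c) , 1/suc-positive _ , λ X F F-max F-small →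
  let k , ℓ , F-labels , blocks = Refinement.refinement X ε F F-max
                                    a (denominator-bound ε 0<ε) c (small-fraction α 0<α α<½ F-small)
  in k , ℓ , F-labels , λ i →
       proj₁ (blocks i) , ½-minus-bound α {∣ F ∣} {∣ part X ℓ i ∣} F-small (<⇒≤ (proj₂ (blocks i)))
  where
  a c : ℕ
  a = ↧ₙ ε
  c = 2 * ↧ₙ α
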